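{- Let $n>1$, $S\subset\{0,1\}^n$ and $1\le i\le n$, and put $S_0=g_{n,i,0}^{ -1}(S)$, $S_1=g_{n,i,1}^{ -1}(S)$ (subsets of $\{0,1\}^{n-1}$). Then $$\mathrm{Type}(S)\le 2\,\mathrm{Type}(S_0)+|S_1\setminus S_0|,\qquad \mathrm{Type}(S)\le 2\,\mathrm{Type}(S_1)+|S_0\setminus S_1|.$$
   Context: For $m\ge1$, a half plane of $\{0,1\}^m$ is a set $\{x\in\{0,1\}^m: x_j=a\}$ with $1\le j\le m$, $a\in\{0,1\}$; for $T\subset\{0,1\}^m$, $\mathrm{Type}(T)=\min_H|T\cap H|$ over all $2m$ half planes $H$ of $\{0,1\}^m$. For $a\in\{0,1\}$, $g_{n,i,a}(x_1\cdots x_{n-1})=x_1\cdots x_{i-1}\,a\,x_i\cdots x_{n-1}$ and $g_{n,i,a}^{ -1}(S)=\{x\in\{0,1\}^{n-1}: g_{n,i,a}(x)\in S\}$. -}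

module Defs where

open import Data.Bool using (Bool; true; false; _∧_; not; if_then_else_)
open import Data.Bool using () renaming (_≟_ to _≟ᵇ_)
open import Data.Nat using (ℕ; zero; suc; _+_; _⊓_)
open import Data.Fin using (Fin)
open import Data.Vec using (Vec; []; _∷_; lookup; insertAt)
open import Data.List using (List; []; _∷_; _++_; map; length; filter; foldr; allFin)
open import Relation.Nullary.Decidable using (does)
open import Relation.Binary.PropositionalEquality using (_≡_)

Subset : ℕ → Set
Subset m = Vec Bool m → Bool

cube : (m : ℕ) → List (Vec Bool m)
cube zero = [] ∷ []
cube (suc m) = map (false ∷_) (cube m) ++ map (true ∷_) (cube m)

card : ∀ {m} → Subset m → ℕ
card {m} T = length (filter (λ x → T x ≟ᵇ true) (cube m))

_∩_ : ∀ {m} → Subset m → Subset m → Subset m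
(A ∩ B) x = A x ∧ B x

_∖_ : ∀ {m} → Subset m → Subset m → Subset m
(A ∖ B) x = A x ∧ not (B x)

halfPlane : ∀ {m} → Fin m → Bool → Subset m
halfPlane j a x = does (lookup x j ≟ᵇ a)

minimum⁺ : ℕ → List ℕ → ℕ
minimum⁺ h t = foldr _⊓_ h t

-- Type(T) = min over all 2m half planes H of |T ∩ H|, for m ≥ 1
-- (written m = suc k so that the set of half planes is nonempty).
Type : ∀ {k} → Subset (suc k) → ℕ
Type {k} T =
  minimum⁺ (card (T ∩ halfPlane Data.Fin.zero false))
    (map (λ j → card (T ∩ halfPlane j false)) (allFin (suc k)) ++
     map (λ j → card (T ∩ halfPlane j true)) (allFin (suc k)))

-- g_{n,i,a}(x_1…x_{n-1}) = x_1…x_{i-1} a x_i…x_{n-1}; here i is 0-indexed.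
g : ∀ {m} → Fin (suc m) → Bool → Vec Bool m → Vec Bool (suc m)
g i a x = insertAt x i a

preimage : ∀ {m} → Fin (suc m) → Bool → Subset (suc m) → Subset m
preimage i a S x = S (g i a x)

{-# OPTIONS --safe #-}
-- Take a half plane H' of {0,1}^{n-1} with Type(S_a) = |S_a ∩ H'| and lift it
-- to the half plane H of {0,1}^n fixing the same coordinate (skipping the
-- inserted position i). Splitting S ∩ H along coordinate i gives
-- |S ∩ H| = |S_a ∩ H'| + |S_{1-a} ∩ H'|, and S_{1-a} ∩ H' is covered by
-- (S_a ∩ H') ∪ (S_{1-a} ∖ S_a).
module Submission where

open import Defs
open import Data.Bool using (Bool; true; false; T; _∧_; _∨_; not)
open import Data.Bool using () renaming (_≟_ to _≟ᵇ_)
open import Data.Nat using (ℕ; zero; suc; _+_; _*_; _≤_; _⊓_; z≤n; s≤s)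
open import Data.Nat.Properties
  using (≤-refl; ≤-reflexive; +-comm; +-assoc; +-identityʳ; +-mono-≤; +-monoʳ-≤;
         ⊓-sel; m≤n⇒m⊓o≤n; m≤n⇒o⊓m≤n; +-commutativeSemigroup; module ≤-Reasoning)
open import Algebra.Properties.CommutativeSemigroup +-commutativeSemigroup using (interchange)
open import Data.Fin using (Fin; punchIn)
open import Data.Empty using (⊥-elim)
open import Data.Product using (_×_; _,_; ∃₂)
open import Data.Sum using (_⊎_; inj₂; [_,_]′)
open import Data.Vec using ([]; _∷_)
open import Data.Vec.Properties using (insertAt-punchIn)
open import Data.List using (List; []; _∷_; _++_; map; length; filter; allFin)
open import Data.List.Properties using (length-++; filter-++; foldr-preservesᵇ; foldr-preservesᵒ)
open import Data.List.Membership.Propositional using (_∈_)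
open import Data.List.Membership.Propositional.Properties using (∈-map⁺; ∈-++⁺ˡ; ∈-++⁺ʳ; ∈-allFin)
open import Data.List.Relation.Unary.All using (All)
import Data.List.Relation.Unary.All.Properties as All
import Data.List.Relation.Unary.Any as Any
open import Relation.Nullary.Decidable using (does)
open import Relation.Unary using (Pred; Decidable)
open import Relation.Binary.PropositionalEquality
open import Function using (_∘_)

private
  variable
    m : ℕ

_∪_ : Subset m → Subset m → Subset m
(A ∪ B) x = A x ∨ B x

_⊆_ : Subset m → Subset m → Set
A ⊆ B = ∀ x → T (A x) → T (B x)

∩-⊆-∩-∪-∖ : (A B H : Subset m) → (B ∩ H) ⊆ ((A ∩ H) ∪ (B ∖ A))
∩-⊆-∩-∪-∖ A B H x with A x | B x | H x
... | true  | true  | true  = _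
... | false | true  | _     = _
... | _     | false | _     = λ ()
... | _     | true  | false = λ ()

length-filter-map : ∀ {a b p} {A : Set a} {B : Set b} {P : Pred B p} (P? : Decidable P)
  (f : A → B) (xs : List A) →
  length (filter P? (map f xs)) ≡ length (filter (λ x → P? (f x)) xs)
length-filter-map P? f [] = refl
length-filter-map P? f (x ∷ xs) with does (P? (f x))
... | true  = cong suc (length-filter-map P? f xs)
... | false = length-filter-map P? f xs

card-∷ : (A : Subset (suc m)) →
  card A ≡ card (λ x → A (false ∷ x)) + card (λ x → A (true ∷ x))
card-∷ {m} A = begin
  card A
    ≡⟨ cong length (filter-++ A? (map (false ∷_) (cube m)) (map (true ∷_) (cube m))) ⟩
  length (filter A? (map (false ∷_) (cube m)) ++ filter A? (map (true ∷_) (cube m)))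
    ≡⟨ length-++ (filter A? (map (false ∷_) (cube m))) ⟩
  length (filter A? (map (false ∷_) (cube m))) + length (filter A? (map (true ∷_) (cube m)))
    ≡⟨ cong₂ _+_ (length-filter-map A? (false ∷_) (cube m)) (length-filter-map A? (true ∷_) (cube m)) ⟩
  card (λ x → A (false ∷ x)) + card (λ x → A (true ∷ x)) ∎
  where
    open ≡-Reasoning
    A? = λ x → A x ≟ᵇ true

card-mono : (A B : Subset m) → A ⊆ B → card A ≤ card B
card-mono {zero} A B A⊆B with A [] | B [] | A⊆B []
... | false | _     | _  = z≤n
... | true  | true  | _  = ≤-refl
... | true  | false | ab = ⊥-elim (ab _)
card-mono {suc m} A B A⊆B = begin
  card A                                                 ≡⟨ card-∷ A ⟩
  card (λ x → A (false ∷ x)) + card (λ x → A (true ∷ x)) ≤⟨ +-mono-≤ (card-mono _ _ (λ x → A⊆B (false ∷ x)))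
                                                                     (card-mono _ _ (λ x → A⊆B (true ∷ x))) ⟩
  card (λ x → B (false ∷ x)) + card (λ x → B (true ∷ x)) ≡⟨ card-∷ B ⟨
  card B                                                 ∎
  where open ≤-Reasoning

card-∪ : (A B : Subset m) → card (A ∪ B) ≤ card A + card B
card-∪ {zero} A B with A [] | B []
... | false | false = z≤n
... | false | true  = ≤-refl
... | true  | _     = s≤s z≤n
card-∪ {suc m} A B = begin
  card (A ∪ B)
    ≡⟨ card-∷ (A ∪ B) ⟩
  card (λ x → (A ∪ B) (false ∷ x)) + card (λ x → (A ∪ B) (true ∷ x))
    ≤⟨ +-mono-≤ (card-∪ A₀ B₀) (card-∪ A₁ B₁) ⟩
  (card A₀ + card B₀) + (card A₁ + card B₁)
    ≡⟨ interchange (card A₀) (card B₀) (card A₁) (card B₁) ⟩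
  (card A₀ + card A₁) + (card B₀ + card B₁)
    ≡⟨ cong₂ _+_ (card-∷ A) (card-∷ B) ⟨
  card A + card B ∎
  where
    open ≤-Reasoning
    A₀ A₁ B₀ B₁ : Subset m
    A₀ x = A (false ∷ x)
    A₁ x = A (true ∷ x)
    B₀ x = B (false ∷ x)
    B₁ x = B (true ∷ x)

card-preimage : (i : Fin (suc m)) (a : Bool) (A : Subset (suc m)) →
  card A ≡ card (preimage i a A) + card (preimage i (not a) A)
card-preimage Fin.zero false A = card-∷ A
card-preimage Fin.zero true  A = trans (card-∷ A) (+-comm (card (λ x → A (false ∷ x))) (card (λ x → A (true ∷ x))))
card-preimage {suc m} (Fin.suc i) a A = begin
  card A
    ≡⟨ card-∷ A ⟩
  card A₀ + card A₁
    ≡⟨ cong₂ _+_ (card-preimage i a A₀) (card-preimage i a A₁) ⟩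
  (card (preimage i a A₀) + card (preimage i (not a) A₀)) + (card (preimage i a A₁) + card (preimage i (not a) A₁))
    ≡⟨ interchange (card (preimage i a A₀)) (card (preimage i (not a) A₀)) (card (preimage i a A₁)) (card (preimage i (not a) A₁)) ⟩
  (card (preimage i a A₀) + card (preimage i a A₁)) + (card (preimage i (not a) A₀) + card (preimage i (not a) A₁))
    ≡⟨ cong₂ _+_ (card-∷ (preimage (Fin.suc i) a A)) (card-∷ (preimage (Fin.suc i) (not a) A)) ⟨
  card (preimage (Fin.suc i) a A) + card (preimage (Fin.suc i) (not a) A) ∎
  where
    open ≡-Reasoning
    A₀ A₁ : Subset (suc m)
    A₀ x = A (false ∷ x)
    A₁ x = A (true ∷ x)

minimum⁺-≤ : ∀ h t {e} → e ∈ t → minimum⁺ h t ≤ e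
minimum⁺-≤ h t {e} e∈t = foldr-preservesᵒ ⊓-≤ h t (inj₂ (Any.map (λ e≡x → ≤-reflexive (sym e≡x)) e∈t))
  where
    ⊓-≤ : ∀ x y → x ≤ e ⊎ y ≤ e → x ⊓ y ≤ e
    ⊓-≤ x y = [ m≤n⇒m⊓o≤n y , m≤n⇒o⊓m≤n x ]′

minimum⁺-preserves : ∀ {p} (P : Pred ℕ p) {h t} → P h → All P t → P (minimum⁺ h t)
minimum⁺-preserves P = foldr-preservesᵇ ⊓-pres
  where
    ⊓-pres : ∀ {x y} → P x → P y → P (x ⊓ y)
    ⊓-pres {x} {y} px py = [ (λ eq → subst P (sym eq) px) , (λ eq → subst P (sym eq) py) ]′ (⊓-sel x y)

halfPlaneCounts : ∀ {k} → Subset (suc k) → Bool → List ℕ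
halfPlaneCounts {k} A b = map (λ j → card (A ∩ halfPlane j b)) (allFin (suc k))

Type-≤ : ∀ {k} (A : Subset (suc k)) (j : Fin (suc k)) (b : Bool) → Type A ≤ card (A ∩ halfPlane j b)
Type-≤ A j false = minimum⁺-≤ _ _ (∈-++⁺ˡ (∈-map⁺ (λ j → card (A ∩ halfPlane j false)) (∈-allFin j)))
Type-≤ A j true  = minimum⁺-≤ _ _ (∈-++⁺ʳ (halfPlaneCounts A false) (∈-map⁺ (λ j → card (A ∩ halfPlane j true)) (∈-allFin j)))

Type-attained : ∀ {k} (A : Subset (suc k)) → ∃₂ λ j b → Type A ≡ card (A ∩ halfPlane j b)
Type-attained {k} A =
  minimum⁺-preserves IsHalfPlaneCount (Fin.zero , false , refl)
    (All.++⁺ (All.map⁺ (All.tabulate⁺ (λ j → j , false , refl)))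
             (All.map⁺ (All.tabulate⁺ (λ j → j , true , refl))))
  where
    IsHalfPlaneCount : Pred ℕ _
    IsHalfPlaneCount c = ∃₂ λ j b → c ≡ card (A ∩ halfPlane j b)

preimage-∩-halfPlane-punchIn : (i : Fin (suc m)) (a : Bool) (S : Subset (suc m)) (j : Fin m) (b : Bool) →
  preimage i a (S ∩ halfPlane (punchIn i j) b) ⊆ (preimage i a S ∩ halfPlane j b)
preimage-∩-halfPlane-punchIn i a S j b x =
  subst (λ h → T (S (g i a x) ∧ h)) (cong (λ xⱼ → does (xⱼ ≟ᵇ b)) (insertAt-punchIn x i a j))

Type-≤-twice-preimage : ∀ {k} (S : Subset (suc (suc k))) (i : Fin (suc (suc k))) (a : Bool) →
  Type S ≤ 2 * Type (preimage i a S) + card (preimage i (not a) S ∖ preimage i a S)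
Type-≤-twice-preimage S i a with Type-attained (preimage i a S)
... | j , b , Type≡c = begin
  Type S
    ≤⟨ Type-≤ S (punchIn i j) b ⟩
  card (S ∩ H)
    ≡⟨ card-preimage i a (S ∩ H) ⟩
  card (preimage i a (S ∩ H)) + card (preimage i (not a) (S ∩ H))
    ≤⟨ +-mono-≤ (card-mono _ _ (preimage-∩-halfPlane-punchIn i a S j b))
                (card-mono _ _ (λ x → ∩-⊆-∩-∪-∖ Sₐ Sₙ H' x ∘ preimage-∩-halfPlane-punchIn i (not a) S j b x)) ⟩
  c + card ((Sₐ ∩ H') ∪ (Sₙ ∖ Sₐ))
    ≤⟨ +-monoʳ-≤ c (card-∪ (Sₐ ∩ H') (Sₙ ∖ Sₐ)) ⟩
  c + (c + d)
    ≡⟨ +-assoc c c d ⟨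
  c + c + d
    ≡⟨ cong (λ c′ → c + c′ + d) (+-identityʳ c) ⟨
  2 * c + d
    ≡⟨ cong (λ t → 2 * t + d) Type≡c ⟨
  2 * Type Sₐ + d ∎
  where
    open ≤-Reasoning
    H = halfPlane (punchIn i j) b
    H' = halfPlane j b
    Sₐ = preimage i a S
    Sₙ = preimage i (not a) S
    c = card (Sₐ ∩ H')
    d = card (Sₙ ∖ Sₐ)

lemma4p8 : (k : ℕ) (S : Subset (suc (suc k))) (i : Fin (suc (suc k))) →
    (Type S ≤ 2 * Type (preimage i false S) + card (preimage i true S ∖ preimage i false S))
    × (Type S ≤ 2 * Type (preimage i true S) + card (preimage i false S ∖ preimage i true S))
lemma4p8 k S i = Type-≤-twice-preimage S i false , Type-≤-twice-preimage S i true
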